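{- Let $\Pi_{42}$ be the map on $\mathbb{N}=\{1,2,3,\dots\}$ produced by the following procedure, with $L(m)=R(m)=\lfloor (m+1)/2\rfloor$. At step $1$ set $\Pi_{42}(1)=1$. For $m=2,3,4,\dots$ in turn, at step $m$: if $\Pi_{42}(m-L(m))$ has not been assigned at an earlier step, set $\Pi_{42}(m-L(m))=m$; otherwise set $\Pi_{42}(m+R(m))=m$. Let $n,k\ge1$ be natural numbers. Then: (a) $\Pi_{42}(n)$ never has type (I); (b) if $n=3k+1$ then $\Pi_{42}(n)$ has type (II); (c) if $n=3k+2$ then $\Pi_{42}(n)$ has type (III); (d) if $n=3k+3$ then $\Pi_{42}(n)$ has type (II) if $\Pi_{42}(k+1)$ has type (II), and $\Pi_{42}(n)$ has type (IV) if $\Pi_{42}(k+1)$ has type (III) or type (IV).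
   Context: The procedure assigns a value $\Pi_{42}(n)$ to every $n\in\mathbb{N}$. Types: $\Pi_{42}(n)$ has type (I) if $\Pi_{42}(n)>n$ and $\Pi_{42}(n)=2n+1$; type (II) if $\Pi_{42}(n)>n$ and $\Pi_{42}(n)=2n$; type (III) if $\Pi_{42}(n)<n$ and $\Pi_{42}(n)=(2n-1)/3$; type (IV) if $\Pi_{42}(n)<n$ and $\Pi_{42}(n)=2n/3$. -}

module Defs where

open import Data.Nat using (ℕ; zero; suc; _+_; _*_; _∸_; _≤_; _<_; _/_)
open import Data.Nat.Properties using (_≟_)
open import Data.List using (List; []; _∷_)
open import Data.List.Membership.DecPropositional _≟_ using (_∈?_)
open import Data.Product using (Σ; _×_)
open import Relation.Nullary using (¬_; yes; no)
open import Relation.Binary.PropositionalEquality using (_≡_)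

L R : ℕ → ℕ
L m = suc m / 2
R m = suc m / 2

step : ℕ → List ℕ → List ℕ
step m prev with (m ∸ L m) ∈? prev
... | yes _ = (m + R m) ∷ prev
... | no  _ = (m ∸ L m) ∷ prev

history : ℕ → List ℕ
history zero = []
history (suc zero) = 1 ∷ []
history (suc (suc m)) = step (suc (suc m)) (history (suc m))

-- position p at which step m (m ≥ 1) sets Π₄₂(p) = m
stepPos : ℕ → ℕ
stepPos m with history m
... | [] = 0
... | p ∷ _ = p

-- Π₄₂(n) = v : some step v ≥ 1 assigns position n, and no later step
-- reassigns it (so v is the value finally held by Π₄₂(n)).
Π42≡ : ℕ → ℕ → Set
Π42≡ n v = (1 ≤ v) × (stepPos v ≡ n) × (∀ m → v < m → ¬ (stepPos m ≡ n))

TypeI TypeII TypeIII TypeIV : ℕ → Set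
TypeI   n = Σ ℕ λ v → Π42≡ n v × (n < v) × (v ≡ 2 * n + 1)
TypeII  n = Σ ℕ λ v → Π42≡ n v × (n < v) × (v ≡ 2 * n)
-- v = (2n-1)/3, stated as 3v = 2n - 1 (with 2n ≥ 1)
TypeIII n = Σ ℕ λ v → Π42≡ n v × (v < n) × (3 * v + 1 ≡ 2 * n)
TypeIV  n = Σ ℕ λ v → Π42≡ n v × (v < n) × (3 * v ≡ 2 * n)

module Submission where

-- The position
-- step m aims at is m ∸ L m, and it is the same for the two consecutive steps
-- 2a+2 and 2a+3, namely a+1.  Hence there are exactly four kinds of steps:
--   step 1 fills position 1;
--   step 2a+2 fills a+1 if a+1 is still free ("fresh"), otherwise it is
--     bumped to (2a+2) + R(2a+2) = 3(a+1);
--   step 2a+3 always finds a+1 taken and is bumped to 3(a+1)+2.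
-- The inductive relation Hit m p describes these four kinds, and is shown to
-- coincide with stepPos m ≡ p (hit-sound, hit).  Π₄₂(n) is the last step hitting
-- n (last-hit), and a fresh hit of n precedes every other hit of n (fresh-first).
-- The theorem then follows by listing, for each residue of n mod 3, which kinds
-- of steps can hit n: residues separate the bumped positions 3(a+1) and
-- 3(a+1)+2 from each other and from n ≡ 1, and the bump maps a ↦ 3(a+1) and
-- a ↦ 3(a+1)+2 are injective.

open import Defs
open import Data.Nat using (ℕ; zero; suc; _+_; _*_; _∸_; _/_; _≤_; _<_; _%_; _≤?_; NonZero; z≤n; s≤s; z<s)
open import Data.Nat.Properties
open import Data.Nat.DivMod using ([m+kn]%n≡m%n; m*n%n≡0; +-distrib-/-∣ʳ; m<n⇒m/n≡0; m*n/n≡m)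
open import Data.Nat.Divisibility using (n∣m*n)
open import Data.Nat.Tactic.RingSolver using (solve-∀)
open import Data.Product using (Σ; _×_; _,_)
open import Data.Sum using (_⊎_; inj₁; inj₂)
open import Data.List using (_∷_)
open import Data.List.Relation.Unary.Any using (here; there)
open import Data.List.Membership.DecPropositional _≟_ using (_∈_; _∉_; _∈?_)
open import Relation.Nullary using (¬_; yes; no; contradiction)
open import Relation.Binary.PropositionalEquality

half : ∀ q {r} → r < 2 → (r + q * 2) / 2 ≡ q
half q {r} r<2 = begin
  (r + q * 2) / 2       ≡⟨ +-distrib-/-∣ʳ r (n∣m*n q) ⟩
  r / 2 + q * 2 / 2     ≡⟨ cong₂ _+_ (m<n⇒m/n≡0 r<2) (m*n/n≡m q 2) ⟩
  q                     ∎
  where open ≡-Reasoning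

residue : ∀ d .{{_ : NonZero d}} q r → (d * q + r) % d ≡ r % d
residue d q r = trans (cong (_% d) (trans (+-comm (d * q) r) (cong (r +_) (*-comm d q))))
                      ([m+kn]%n≡m%n r q d)

multiple : ∀ d .{{_ : NonZero d}} q → (d * q) % d ≡ 0
multiple d q = trans (cong (_% d) (*-comm d q)) (m*n%n≡0 q d)

different-residues : ∀ d .{{_ : NonZero d}} {x y r s} →
                     x % d ≡ r → y % d ≡ s → r ≢ s → x ≢ y
different-residues d x%d y%d r≢s x≡y = r≢s (trans (sym x%d) (trans (cong (_% d) x≡y) y%d))

-- Step 2(a+1), in the shape the step function unfolds on.
double : ∀ a → 2 * (1 + a) ≡ 2 + a + a
double = solve-∀

triple-injective : ∀ {a b} → 3 * (1 + a) ≡ 3 * (1 + b) → a ≡ b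
triple-injective {a} {b} e = suc-injective (*-cancelˡ-≡ (1 + a) (1 + b) 3 e)

triple+2-injective : ∀ {a b} → 3 * (1 + a) + 2 ≡ 3 * (1 + b) + 2 → a ≡ b
triple+2-injective {a} {b} e = triple-injective (+-cancelʳ-≡ 2 (3 * (1 + a)) (3 * (1 + b)) e)

L-even : ∀ a → L (2 + a + a) ≡ 1 + a
L-even a = trans (cong (_/ 2) (as-halvable a)) (half (1 + a) (s≤s (s≤s z≤n)))
  where
  as-halvable : ∀ a → 3 + a + a ≡ 1 + (1 + a) * 2
  as-halvable = solve-∀

L-odd : ∀ a → L (3 + a + a) ≡ 2 + a
L-odd a = trans (cong (_/ 2) (as-halvable a)) (half (2 + a) (s≤s z≤n))
  where
  as-halvable : ∀ a → 4 + a + a ≡ 0 + (2 + a) * 2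
  as-halvable = solve-∀

target-even : ∀ a → 2 + a + a ∸ L (2 + a + a) ≡ 1 + a
target-even a = trans (cong (2 + a + a ∸_) (L-even a)) (m+n∸n≡m (1 + a) a)

target-odd : ∀ a → 3 + a + a ∸ L (3 + a + a) ≡ 1 + a
target-odd a = trans (cong (3 + a + a ∸_) (L-odd a)) (m+n∸n≡m (1 + a) a)

even-bump-distance : ∀ a → 2 + a + a + (1 + a) ≡ 3 * (1 + a)
even-bump-distance = solve-∀

odd-bump-distance : ∀ a → 3 + a + a + (2 + a) ≡ 3 * (1 + a) + 2
odd-bump-distance = solve-∀

bumped-even : ∀ a → 2 + a + a + R (2 + a + a) ≡ 3 * (1 + a)
bumped-even a = trans (cong (2 + a + a +_) (L-even a)) (even-bump-distance a)

bumped-odd : ∀ a → 3 + a + a + R (3 + a + a) ≡ 3 * (1 + a) + 2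
bumped-odd a = trans (cong (3 + a + a +_) (L-odd a)) (odd-bump-distance a)

history-suc : ∀ m → history (suc m) ≡ stepPos (suc m) ∷ history m
history-suc zero = refl
history-suc (suc m) with (2 + m ∸ L (2 + m)) ∈? history (suc m)
... | yes _ = refl
... | no  _ = refl

assigned-before : ∀ {t} m → 1 ≤ t → t ≤ m → stepPos t ∈ history m
assigned-before zero t≥1 t≤0 = contradiction (≤-trans t≥1 t≤0) λ ()
assigned-before {t} (suc m) t≥1 t≤1+m rewrite history-suc m with t ≟ suc m
... | yes refl = here refl
... | no  t≢1+m = there (assigned-before m t≥1 (≤-pred (≤∧≢⇒< t≤1+m t≢1+m)))

assigned-by : ∀ {x} m → x ∈ history m → Σ ℕ λ t → 1 ≤ t × t ≤ m × stepPos t ≡ x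
assigned-by (suc m) x∈ rewrite history-suc m with x∈
... | here x≡ = suc m , s≤s z≤n , ≤-refl , sym x≡
... | there x∈′ with assigned-by m x∈′
...   | t , t≥1 , t≤m , t↦x = t , t≥1 , m≤n⇒m≤1+n t≤m , t↦x

stepPos-free : ∀ j → (2 + j ∸ L (2 + j)) ∉ history (1 + j) → stepPos (2 + j) ≡ 2 + j ∸ L (2 + j)
stepPos-free j free with (2 + j ∸ L (2 + j)) ∈? history (1 + j)
... | yes taken = contradiction taken free
... | no  _     = refl

stepPos-taken : ∀ j → (2 + j ∸ L (2 + j)) ∈ history (1 + j) → stepPos (2 + j) ≡ 2 + j + R (2 + j)
stepPos-taken j taken with (2 + j ∸ L (2 + j)) ∈? history (1 + j)
... | yes _    = refl
... | no  free = contradiction taken free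

stepPos-even-free : ∀ a → 1 + a ∉ history (1 + a + a) → stepPos (2 + a + a) ≡ 1 + a
stepPos-even-free a free =
  trans (stepPos-free (a + a) (subst (_∉ history (1 + a + a)) (sym (target-even a)) free))
        (target-even a)

stepPos-even-taken : ∀ a → 1 + a ∈ history (1 + a + a) → stepPos (2 + a + a) ≡ 3 * (1 + a)
stepPos-even-taken a taken =
  trans (stepPos-taken (a + a) (subst (_∈ history (1 + a + a)) (sym (target-even a)) taken))
        (bumped-even a)

-- After step 2a+2, position a+1 is always taken, so step 2a+3 is bumped.
stepPos-odd : ∀ a → stepPos (3 + a + a) ≡ 3 * (1 + a) + 2
stepPos-odd a =
  trans (stepPos-taken (1 + a + a) (subst (_∈ history (2 + a + a)) (sym (target-odd a)) taken))
        (bumped-odd a)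
  where
  taken : 1 + a ∈ history (2 + a + a)
  taken rewrite history-suc (1 + a + a) with 1 + a ∈? history (1 + a + a)
  ... | yes earlier = there earlier
  ... | no  free    = here (sym (stepPos-even-free a free))

data StepIndex : ℕ → Set where
  one  : StepIndex 1
  even : ∀ a → StepIndex (2 + a + a)
  odd  : ∀ a → StepIndex (3 + a + a)

step-index : ∀ m → StepIndex (suc m)
step-index zero = one
step-index (suc m) with step-index m
... | one    = even 0
... | even a = odd a
... | odd  a = subst StepIndex (cong (3 +_) (+-suc a a)) (even (1 + a))

data Hit : ℕ → ℕ → Set where
  initial  : Hit 1 1
  fresh    : ∀ a → 1 + a ∉ history (1 + a + a) → Hit (2 + a + a) (1 + a)
  bumpEven : ∀ a → 1 + a ∈ history (1 + a + a) → Hit (2 + a + a) (3 * (1 + a))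
  bumpOdd  : ∀ a → Hit (3 + a + a) (3 * (1 + a) + 2)

hit-sound : ∀ {m p} → Hit m p → stepPos m ≡ p
hit-sound initial            = refl
hit-sound (fresh a free)     = stepPos-even-free a free
hit-sound (bumpEven a taken) = stepPos-even-taken a taken
hit-sound (bumpOdd a)        = stepPos-odd a

hit : ∀ {m p} → 1 ≤ m → stepPos m ≡ p → Hit m p
hit {suc m} _ refl = hit-of (suc m) (step-index m)
  where
  hit-of : ∀ m → StepIndex m → Hit m (stepPos m)
  hit-of _ one = initial
  hit-of _ (even a) with 1 + a ∈? history (1 + a + a)
  ... | yes taken = subst (Hit _) (sym (stepPos-even-taken a taken)) (bumpEven a taken)
  ... | no  free  = subst (Hit _) (sym (stepPos-even-free a free)) (fresh a free)
  hit-of _ (odd a) = subst (Hit _) (sym (stepPos-odd a)) (bumpOdd a)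

last-hit : ∀ {n v} → 1 ≤ v → stepPos v ≡ n → (∀ {m p} → Hit m p → p ≡ n → m ≤ v) → Π42≡ n v
last-hit v≥1 v↦n latest =
  v≥1 , v↦n , λ m v<m m↦n → <⇒≱ v<m (latest (hit (≤-trans v≥1 (<⇒≤ v<m)) m↦n) refl)

fresh-first : ∀ {a v} → 1 + a ∉ history (1 + a + a) → 1 ≤ v → stepPos v ≡ 1 + a → 2 + a + a ≤ v
fresh-first {a} {v} free v≥1 v↦ with 2 + a + a ≤? v
... | yes in-order = in-order
... | no  too-late =
  contradiction (subst (_∈ history (1 + a + a)) v↦
                       (assigned-before (1 + a + a) v≥1 (≤-pred (≰⇒> too-late))))
                free

-- (a) A value 2n+1 is an odd step, and odd steps are bumped to the right of n.
not-typeI : ∀ n → 1 ≤ n → ¬ TypeI n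
not-typeI (suc i) _ (v , (_ , v↦n , _) , _ , v≡2n+1) =
  <⇒≢ n<bumped (trans (sym odd-step-hits-n) (stepPos-odd i))
  where
  odd-step : ∀ i → 2 * (1 + i) + 1 ≡ 3 + i + i
  odd-step = solve-∀
  odd-step-hits-n : stepPos (3 + i + i) ≡ 1 + i
  odd-step-hits-n = subst (λ w → stepPos w ≡ 1 + i) (trans v≡2n+1 (odd-step i)) v↦n
  n<bumped : 1 + i < 3 * (1 + i) + 2
  n<bumped = ≤-<-trans (m≤m+n (1 + i) (2 * (1 + i))) (m<m+n (3 * (1 + i)) z<s)

sole-hitter : ∀ n → 1 ≤ n → (∀ {m p} → Hit m p → p ≡ n → m ≡ 2 * n) → TypeII n
sole-hitter (suc i) _ only =
  2 + i + i , last-hit (s≤s z≤n) hits (λ h e → ≤-reflexive (trans (only h e) (double i))) ,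
  s≤s (s≤s (m≤m+n i i)) , sym (double i)
  where
  free : 1 + i ∉ history (1 + i + i)
  free taken with assigned-by (1 + i + i) taken
  ... | t , t≥1 , t≤2n-1 , t↦n =
    1+n≰n (subst (_≤ 1 + i + i) (trans (only (hit t≥1 t↦n) refl) (double i)) t≤2n-1)
  hits : stepPos (2 + i + i) ≡ 1 + i
  hits = stepPos-even-free i free

fresh-is-double : ∀ {a n} → 1 + a ≡ n → 2 + a + a ≡ 2 * n
fresh-is-double {a} refl = sym (double a)

-- (b) Positions 3k+1 > 1 are only reachable by a fresh step.
typeII-3k+1 : ∀ k → 1 ≤ k → TypeII (3 * k + 1)
typeII-3k+1 (suc k) _ = sole-hitter n (s≤s z≤n) only
  where
  n : ℕ
  n = 3 * suc k + 1
  only : ∀ {m p} → Hit m p → p ≡ n → m ≡ 2 * n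
  only initial e with +-cancelʳ-≡ 1 0 (3 * suc k) e
  ... | ()
  only (fresh a _) e = fresh-is-double e
  only (bumpEven a _) e =
    contradiction e (different-residues 3 (multiple 3 (1 + a)) (residue 3 (suc k) 1) λ ())
  only (bumpOdd a) e =
    contradiction e (different-residues 3 (residue 3 (1 + a) 2) (residue 3 (suc k) 1) λ ())

-- (c) Position 3(a+1)+2 is bumped into by step 2a+3; a later fresh hit is
-- impossible and no other bumped step reaches it.
typeIII-3k+2 : ∀ k → 1 ≤ k → TypeIII (3 * k + 2)
typeIII-3k+2 (suc a) _ =
  3 + a + a , last-hit (s≤s z≤n) (stepPos-odd a) latest ,
  subst (3 + a + a <_) (odd-bump-distance a) (m<m+n (3 + a + a) z<s) , thirds a
  where
  thirds : ∀ a → 3 * (3 + a + a) + 1 ≡ 2 * (3 * (1 + a) + 2)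
  thirds = solve-∀
  latest : ∀ {m p} → Hit m p → p ≡ 3 * (1 + a) + 2 → m ≤ 3 + a + a
  latest initial _ = s≤s z≤n
  latest (fresh b free) e = fresh-first free (s≤s z≤n) (trans (stepPos-odd a) (sym e))
  latest (bumpEven b _) e =
    contradiction e (different-residues 3 (multiple 3 (1 + b)) (residue 3 (1 + a) 2) λ ())
  latest (bumpOdd b) e with triple+2-injective e
  ... | refl = ≤-refl

-- (d), first case: if step 2k+2 freshly fills k+1, then step 2(3k+3) is the
-- only step that can hit 3k+3.
typeII-3k+3 : ∀ k → TypeII (1 + k) → TypeII (3 * (1 + k))
typeII-3k+3 k (v , (_ , v↦ , _) , _ , v≡2n) = sole-hitter (3 * (1 + k)) (s≤s z≤n) only
  where
  fresh-at-2k+2 : stepPos (2 + k + k) ≡ 1 + k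
  fresh-at-2k+2 = subst (λ w → stepPos w ≡ 1 + k) (trans v≡2n (double k)) v↦
  only : ∀ {m p} → Hit m p → p ≡ 3 * (1 + k) → m ≡ 2 * (3 * (1 + k))
  only initial e = contradiction e (different-residues 3 refl (multiple 3 (1 + k)) λ ())
  only (fresh a _) e = fresh-is-double e
  only h@(bumpEven a _) e with triple-injective e
  ... | refl = contradiction (trans (sym fresh-at-2k+2) (hit-sound h))
                             (<⇒≢ (m<m+n (1 + k) z<s))
  only (bumpOdd a) e =
    contradiction e (different-residues 3 (residue 3 (1 + a) 2) (multiple 3 (1 + k)) λ ())

-- (d), second case: if k+1 is filled before step k+1, then step 2k+2 is
-- bumped to 3k+3, and no later step hits 3k+3.
typeIV-3k+3 : ∀ k {v} → 1 ≤ v → v < 1 + k → stepPos v ≡ 1 + k → TypeIV (3 * (1 + k))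
typeIV-3k+3 k {v} v≥1 v<1+k v↦ =
  2 + k + k , last-hit (s≤s z≤n) bumped latest ,
  subst (2 + k + k <_) (even-bump-distance k) (m<m+n (2 + k + k) z<s) , thirds k
  where
  thirds : ∀ k → 3 * (2 + k + k) ≡ 2 * (3 * (1 + k))
  thirds = solve-∀
  bumped : stepPos (2 + k + k) ≡ 3 * (1 + k)
  bumped = stepPos-even-taken k (subst (_∈ history (1 + k + k)) v↦
             (assigned-before (1 + k + k) v≥1 (m≤n⇒m≤1+n (≤-trans (≤-pred v<1+k) (m≤m+n k k)))))
  latest : ∀ {m p} → Hit m p → p ≡ 3 * (1 + k) → m ≤ 2 + k + k
  latest initial _ = s≤s z≤n
  latest (fresh b free) e = fresh-first free (s≤s z≤n) (trans bumped (sym e))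
  latest (bumpEven b _) e with triple-injective e
  ... | refl = ≤-refl
  latest (bumpOdd b) e =
    contradiction e (different-residues 3 (residue 3 (1 + b) 2) (multiple 3 (1 + k)) λ ())

theorem6 : ((n : ℕ) → 1 ≤ n → ¬ TypeI n)
         × ((k : ℕ) → 1 ≤ k → TypeII (3 * k + 1))
         × ((k : ℕ) → 1 ≤ k → TypeIII (3 * k + 2))
         × ((k : ℕ) → 1 ≤ k →
             (TypeII (k + 1) → TypeII (3 * k + 3))
             × (TypeIII (k + 1) ⊎ TypeIV (k + 1) → TypeIV (3 * k + 3)))
theorem6 = not-typeI , typeII-3k+1 , typeIII-3k+2 , part-d
  where
  triple : ∀ k → 3 * k + 3 ≡ 3 * (1 + k)
  triple = solve-∀
  part-d : (k : ℕ) → 1 ≤ k →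
           (TypeII (k + 1) → TypeII (3 * k + 3))
           × (TypeIII (k + 1) ⊎ TypeIV (k + 1) → TypeIV (3 * k + 3))
  part-d k _ rewrite +-comm k 1 | triple k = typeII-3k+3 k , from-smaller-value
    where
    from-smaller-value : TypeIII (1 + k) ⊎ TypeIV (1 + k) → TypeIV (3 * (1 + k))
    from-smaller-value (inj₁ (v , (v≥1 , v↦ , _) , v<n , _)) = typeIV-3k+3 k v≥1 v<n v↦
    from-smaller-value (inj₂ (v , (v≥1 , v↦ , _) , v<n , _)) = typeIV-3k+3 k v≥1 v<n v↦
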